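{- A minimum size 2-CNF encoding of $\mathrm{AMO}_n$ has no unit implicates, is a prime P-encoding, and its size is equal to $S_2(n)$, the minimum size of a 2-CNF P-encoding with $n$ input variables.
   Context: A CNF formula is a conjunction (set) of clauses (disjunctions of literals with no complementary pair); its size is its number of clauses; a 2-CNF formula has all clauses of at most two literals. A clause is an implicate of $\varphi$ if every satisfying assignment of $\varphi$ satisfies it (a unit implicate is a one-literal implicate); it is a prime implicate if no proper subclause is an implicate; $\varphi$ is prime if all its clauses are prime implicates. $\mathrm{AMO}_n(x_1,\dots,x_n)=1$ iff at most one $x_i$ is $1$. A CNF $\varphi(\mathbf{x},\mathbf{y})$ with input variables $\mathbf{x}=(x_1,\dots,x_n)$ and auxiliary variables $\mathbf{y}=(y_1,\dots,y_\ell)$ is an encoding of $f(\mathbf{x})$ if for all $\alpha\in\{0,1\}^n$: $f(\alpha)=1$ iff $\exists\beta\in\{0,1\}^\ell$, $\varphi(\alpha,\beta)=1$. Unit resolution: from a unit clause $l$ and a clause containing $\neg l$ derive the clause with $\neg l$ removed; $\varphi\wedge g\vdash_1 h$ means the literal $h$ is derivable from $\varphi$ and the unit clause $g$ by a sequence of unit resolutions. $\varphi(\mathbf{x},\mathbf{y})$ is a P-encoding if (P1) $\varphi\wedge x_i$ is satisfiable for each $i$ and (P2) $\varphi\wedge x_i\vdash_1\neg x_j$ for all $i\ne j$. -}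

module Defs where

open import Data.Nat using (ℕ; _≤_)
open import Data.Fin using (Fin)
open import Data.Fin.Properties using () renaming (_≟_ to _≟F_)
open import Data.Bool using (Bool; true; false; not)
open import Data.Bool.Properties using () renaming (_≟_ to _≟B_)
open import Data.Sum using (_⊎_; inj₁; inj₂; [_,_])
import Data.Sum.Properties as SumP
open import Data.Product using (Σ; _×_; _,_; ∃; ∃-syntax)
import Data.Product.Properties as ProdP
open import Data.List using (List; []; _∷_; length; filter)
open import Data.List.Membership.Propositional using (_∈_)
open import Data.List.Relation.Binary.Subset.Propositional using (_⊆_)
open import Data.List.Relation.Unary.All using (All)
open import Data.List.Relation.Unary.Any using (Any)
open import Data.List.Relation.Unary.AllPairs using (AllPairs)
open import Data.List.Relation.Unary.Unique.Propositional using (Unique)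
open import Relation.Binary.PropositionalEquality using (_≡_; _≢_)
open import Relation.Binary.Definitions using (DecidableEquality)
open import Relation.Nullary using (¬_; ¬?)
open import Function.Bundles using (_⇔_)

-- Variables: n input variables x_i = inj₁ i, ℓ auxiliary variables y_k = inj₂ k.
Var : ℕ → ℕ → Set
Var n ℓ = Fin n ⊎ Fin ℓ

-- A literal: a variable together with a polarity (true = positive literal v,
-- false = negative literal ¬v).
Lit : ℕ → ℕ → Set
Lit n ℓ = Var n ℓ × Bool

neg : ∀ {n ℓ} → Lit n ℓ → Lit n ℓ
neg (v , b) = (v , not b)

_≟L_ : ∀ {n ℓ} → DecidableEquality (Lit n ℓ)
_≟L_ = ProdP.≡-dec (SumP.≡-dec _≟F_ _≟F_) _≟B_

-- Clauses and CNF formulas (as lists; well-formedness below makes them sets).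
Clause : ℕ → ℕ → Set
Clause n ℓ = List (Lit n ℓ)

CNF : ℕ → ℕ → Set
CNF n ℓ = List (Clause n ℓ)

WFClause : ∀ {n ℓ} → Clause n ℓ → Set
WFClause c = Unique c × (∀ l → l ∈ c → ¬ (neg l ∈ c))

SameClause : ∀ {n ℓ} → Clause n ℓ → Clause n ℓ → Set
SameClause c d = c ⊆ d × d ⊆ c

WFCNF : ∀ {n ℓ} → CNF n ℓ → Set
WFCNF φ = All WFClause φ × AllPairs (λ c d → ¬ SameClause c d) φ

size : ∀ {n ℓ} → CNF n ℓ → ℕ
size φ = length φ

Is2CNF : ∀ {n ℓ} → CNF n ℓ → Set
Is2CNF φ = All (λ c → length c ≤ 2) φ

Assignment : ℕ → ℕ → Set
Assignment n ℓ = Var n ℓ → Bool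

SatLit : ∀ {n ℓ} → Assignment n ℓ → Lit n ℓ → Set
SatLit a (v , b) = a v ≡ b

SatClause : ∀ {n ℓ} → Assignment n ℓ → Clause n ℓ → Set
SatClause a c = Any (SatLit a) c

Sat : ∀ {n ℓ} → Assignment n ℓ → CNF n ℓ → Set
Sat a φ = All (SatClause a) φ

Implicate : ∀ {n ℓ} → CNF n ℓ → Clause n ℓ → Set
Implicate φ c = ∀ a → Sat a φ → SatClause a c

UnitImplicate : ∀ {n ℓ} → CNF n ℓ → Lit n ℓ → Set
UnitImplicate φ l = Implicate φ (l ∷ [])

HasNoUnitImplicates : ∀ {n ℓ} → CNF n ℓ → Set
HasNoUnitImplicates φ = ∀ l → ¬ UnitImplicate φ l

ProperSubclause : ∀ {n ℓ} → Clause n ℓ → Clause n ℓ → Set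
ProperSubclause d c = d ⊆ c × ¬ (c ⊆ d)

PrimeImplicate : ∀ {n ℓ} → CNF n ℓ → Clause n ℓ → Set
PrimeImplicate φ c =
  Implicate φ c × (∀ d → ProperSubclause d c → ¬ Implicate φ d)

IsPrime : ∀ {n ℓ} → CNF n ℓ → Set
IsPrime φ = All (PrimeImplicate φ) φ

AMO : ∀ n → (Fin n → Bool) → Set
AMO n α = ∀ i j → α i ≡ true → α j ≡ true → i ≡ j

_⊕_ : ∀ {n ℓ} → (Fin n → Bool) → (Fin ℓ → Bool) → Assignment n ℓ
α ⊕ β = [ α , β ]

EncodesAMO : ∀ {n ℓ} → CNF n ℓ → Set
EncodesAMO {n} {ℓ} φ =
  ∀ (α : Fin n → Bool) → AMO n α ⇔ (∃[ β ] Sat (α ⊕ β) φ)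

removeLit : ∀ {n ℓ} → Lit n ℓ → Clause n ℓ → Clause n ℓ
removeLit m c = filter (λ k → ¬? (k ≟L m)) c

data UDerives {n ℓ} (φ : CNF n ℓ) (g : Lit n ℓ) : Clause n ℓ → Set where
  axiom : ∀ {c} → c ∈ φ → UDerives φ g c
  unit  : UDerives φ g (g ∷ [])
  resolve : ∀ {l c} → UDerives φ g (l ∷ []) → UDerives φ g c →
            neg l ∈ c → UDerives φ g (removeLit (neg l) c)

_∧_⊢₁_ : ∀ {n ℓ} → CNF n ℓ → Lit n ℓ → Lit n ℓ → Set
φ ∧ g ⊢₁ h = UDerives φ g (h ∷ [])

pos : ∀ {n ℓ} → Var n ℓ → Lit n ℓ
pos v = (v , true)

negv : ∀ {n ℓ} → Var n ℓ → Lit n ℓ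
negv v = (v , false)

IsPEncoding : ∀ {n ℓ} → CNF n ℓ → Set
IsPEncoding {n} {ℓ} φ =
  (∀ (i : Fin n) → ∃[ a ] (Sat a φ × a (inj₁ i) ≡ true))
  × (∀ (i j : Fin n) → i ≢ j → φ ∧ pos (inj₁ i) ⊢₁ negv (inj₁ j))

IsMin2CNFEncodingAMO : ∀ {n ℓ} → CNF n ℓ → Set
IsMin2CNFEncodingAMO {n} {ℓ} φ =
  WFCNF φ × Is2CNF φ × EncodesAMO φ
  × (∀ (ℓ' : ℕ) (ψ : CNF n ℓ') → WFCNF ψ → Is2CNF ψ → EncodesAMO ψ →
       size φ ≤ size ψ)

IsS₂ : ℕ → ℕ → Set
IsS₂ n k =
  (∃[ ℓ ] Σ (CNF n ℓ) λ ψ → WFCNF ψ × Is2CNF ψ × IsPEncoding ψ × size ψ ≡ k)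
  × (∀ (ℓ : ℕ) (ψ : CNF n ℓ) → WFCNF ψ → Is2CNF ψ → IsPEncoding ψ → k ≤ size ψ)

module Submission where

-- A literal x_i fails in the model of φ extending the
--   all-false input vector, ¬x_i in the model extending the unit vector e_i.
--   If a literal l on an auxiliary variable were implied, deleting the clauses
--   containing l and the literal ¬l elsewhere (module Eliminate) would give a
--   strictly smaller 2-CNF encoding of AMO_n.
-- * Prime.  A proper subclause of a clause with at most two literals mentions
--   at most one literal, so a non-prime clause would yield a unit implicate.
-- * P-encoding.  (P1) comes from the models of e_i.  For (P2) saturate x_i under
--   unit propagation (module Propagation); if ¬x_j is not reached, gluing the
--   models of e_i and e_j along the saturated set gives a model of φ with
--   x_i = x_j = 1, which an encoding of AMO_n cannot have.
-- * Size.  φ is itself a 2-CNF P-encoding.  Conversely, the clauses of any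
--   2-CNF P-encoding ψ without a positive input literal already encode AMO_n
--   (module NegativePart, via the bitwise majority of three models), so
--   size φ ≤ size ψ.

open import Defs
open import Data.Nat using (ℕ; zero; suc; _≤_; _<_; z≤n; s≤s; s≤s⁻¹)
open import Data.Nat.Properties using (≤-trans; <-≤-trans; m≤n⇒m≤1+n; n<1+n; <-irrefl; module ≤-Reasoning)
open import Data.Fin as Fin using (Fin)
open import Data.Fin.Properties as FinP using () renaming (_≟_ to _≟F_)
open import Data.Bool using (Bool; true; false; not; if_then_else_; _∧_; _∨_)
open import Data.Bool.Properties using (not-involutive; not-¬; ¬-not) renaming (_≟_ to _≟B_)
open import Data.Sum using (_⊎_; inj₁; inj₂; [_,_]; swap)
open import Data.Product using (Σ; _×_; _,_; ∃-syntax; proj₁; proj₂)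
open import Data.List using (List; []; _∷_; length; filter; map; _++_; allFin; cartesianProduct; deduplicate)
open import Data.List.Properties using (filter-accept; filter-reject; length-filter; filter-notAll; length-map)
open import Data.List.Membership.Propositional using (_∈_; _∉_; find; lose)
open import Data.List.Membership.Propositional.Properties
  using (∈-map⁺; ∈-map⁻; ∈-filter⁺; ∈-filter⁻; ∈-++⁺ˡ; ∈-++⁺ʳ; ∈-allFin; ∈-cartesianProduct⁺)
open import Data.List.Relation.Unary.All as All using (All; []; _∷_)
open import Data.List.Relation.Unary.Any as Any using (Any; here; there)
open import Data.List.Relation.Unary.AllPairs using ([]; _∷_)
open import Data.Empty using (⊥; ⊥-elim)
open import Data.Unit using (⊤; tt)
open import Relation.Binary.PropositionalEquality using (_≡_; _≢_; refl; sym; trans; cong; subst)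
open import Relation.Nullary using (¬_; Dec; yes; no; ¬?; does; _⊎-dec_; _×-dec_)
open import Relation.Nullary.Decidable using (dec-true; dec-false; decidable-stable)
open import Relation.Binary.Definitions using (DecidableEquality)
import Data.Sum.Properties as SumP
import Data.List.Relation.Unary.Unique.Propositional.Properties as UniqueP
open import Data.List.Relation.Unary.Unique.DecSetoid.Properties using (deduplicate-!)
import Data.List.Relation.Unary.Any.Properties as AnyP
import Data.List.Relation.Unary.All.Properties as AllP
import Data.List.Relation.Unary.AllPairs.Properties as AllPairsP
open import Data.List.Relation.Binary.Subset.Propositional.Properties using (⊆-refl; ⊆-trans)
open import Relation.Binary.Bundles using (DecSetoid)
open import Level using (0ℓ)
import Data.List.Membership.DecPropositional as DecMembership
open import Function.Bundles using (_⇔_; mk⇔; Equivalence)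
open import Function.Base using (_∘_)

majority : Bool → Bool → Bool → Bool
majority x y z = if x then y ∨ z else y ∧ z

majority-12 : ∀ x y z {t} → x ≡ t → y ≡ t → majority x y z ≡ t
majority-12 true  true  z refl refl = refl
majority-12 false false z refl refl = refl

majority-13 : ∀ x y z {t} → x ≡ t → z ≡ t → majority x y z ≡ t
majority-13 true  true  true  refl refl = refl
majority-13 true  false true  refl refl = refl
majority-13 false true  false refl refl = refl
majority-13 false false false refl refl = refl

majority-23 : ∀ x y z {t} → y ≡ t → z ≡ t → majority x y z ≡ t
majority-23 true  true  true  refl refl = refl
majority-23 true  false false refl refl = refl
majority-23 false true  true  refl refl = refl
majority-23 false false false refl refl = refl

two-of-three : ∀ {A : Set} {P Q R : A → Set} {xs : List A} → length xs ≤ 2 →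
  Any P xs → Any Q xs → Any R xs →
  Any (λ x → P x × Q x) xs ⊎ Any (λ x → P x × R x) xs ⊎ Any (λ x → Q x × R x) xs
two-of-three {xs = _ ∷ _ ∷ _ ∷ _} (s≤s (s≤s ()))
two-of-three _ (here p)         (here q)         _                = inj₁ (here (p , q))
two-of-three _ (there (here p)) (there (here q)) _                = inj₁ (there (here (p , q)))
two-of-three _ (here p)         (there (here q)) (here r)         = inj₂ (inj₁ (here (p , r)))
two-of-three _ (here p)         (there (here q)) (there (here r)) = inj₂ (inj₂ (there (here (q , r))))
two-of-three _ (there (here p)) (here q)         (here r)         = inj₂ (inj₂ (here (q , r)))
two-of-three _ (there (here p)) (here q)         (there (here r)) = inj₂ (inj₁ (there (here (p , r))))

all-or-exception : ∀ {A E : Set} {P : A → Set} (xs : List A) →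
  (∀ {x} → x ∈ xs → E ⊎ P x) → E ⊎ All P xs
all-or-exception []       check = inj₂ []
all-or-exception (x ∷ xs) check with check (here refl) | all-or-exception xs (λ m → check (there m))
... | inj₁ e  | _         = inj₁ e
... | inj₂ px | inj₁ e    = inj₁ e
... | inj₂ px | inj₂ pxs  = inj₂ (px ∷ pxs)

module _ {A : Set} {P Q : A → Set} (P? : ∀ x → Dec (P x)) (Q? : ∀ x → Dec (Q x))
         (Q⇒P : ∀ {x} → Q x → P x) where

  filter-antitone : ∀ xs → length (filter Q? xs) ≤ length (filter P? xs)
  filter-antitone []       = z≤n
  filter-antitone (x ∷ xs) with P? x | Q? x
  ... | yes _  | yes _ = s≤s (filter-antitone xs)
  ... | yes _  | no _  = m≤n⇒m≤1+n (filter-antitone xs)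
  ... | no ¬px | yes q = ⊥-elim (¬px (Q⇒P q))
  ... | no _   | no _  = filter-antitone xs

  filter-antitone-strict : ∀ {m} xs → m ∈ xs → P m → ¬ Q m →
                           length (filter Q? xs) < length (filter P? xs)
  filter-antitone-strict (x ∷ xs) (here refl) pm ¬qm with P? x | Q? x
  ... | yes _  | yes qm = ⊥-elim (¬qm qm)
  ... | yes _  | no _   = s≤s (filter-antitone xs)
  ... | no ¬pm | _      = ⊥-elim (¬pm pm)
  filter-antitone-strict (x ∷ xs) (there m∈xs) pm ¬qm with P? x | Q? x
  ... | yes _  | yes _ = s≤s (filter-antitone-strict xs m∈xs pm ¬qm)
  ... | yes _  | no _  = m≤n⇒m≤1+n (filter-antitone-strict xs m∈xs pm ¬qm)
  ... | no ¬px | yes q = ⊥-elim (¬px (Q⇒P q))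
  ... | no _   | no _  = filter-antitone-strict xs m∈xs pm ¬qm

module _ {n ℓ : ℕ} where

  _∈?_ : (l : Lit n ℓ) (c : List (Lit n ℓ)) → Dec (l ∈ c)
  _∈?_ = DecMembership._∈?_ _≟L_

  neg-involutive : (l : Lit n ℓ) → neg (neg l) ≡ l
  neg-involutive (v , b) = cong (v ,_) (not-involutive b)

  SatLit-neg : (a : Assignment n ℓ) (l : Lit n ℓ) → SatLit a l → ¬ SatLit a (neg l)
  SatLit-neg a (v , b) al anl = not-¬ al anl

  removeLit? : (m : Lit n ℓ) (k : Lit n ℓ) → Dec (¬ k ≡ m)
  removeLit? m k = ¬? (k ≟L m)

  ∈-removeLit⁺ : ∀ {m p : Lit n ℓ} {c} → p ∈ c → p ≢ m → p ∈ removeLit m c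
  ∈-removeLit⁺ {m} = ∈-filter⁺ (removeLit? m)

  ∈-removeLit⁻ : ∀ {m p : Lit n ℓ} {c} → p ∈ removeLit m c → p ∈ c × p ≢ m
  ∈-removeLit⁻ {m} = ∈-filter⁻ (removeLit? m)

  removeLit-first : ∀ {p q : Lit n ℓ} → p ≢ q → removeLit p (p ∷ q ∷ []) ≡ q ∷ []
  removeLit-first {p} p≢q =
    trans (filter-reject (removeLit? p) (λ p≢p → p≢p refl))
          (filter-accept (removeLit? p) (λ q≡p → p≢q (sym q≡p)))

  removeLit-second : ∀ {p q : Lit n ℓ} → p ≢ q → removeLit q (p ∷ q ∷ []) ≡ p ∷ []
  removeLit-second {q = q} p≢q =
    trans (filter-accept (removeLit? q) p≢q)
          (cong (_ ∷_) (filter-reject (removeLit? q) (λ q≢q → q≢q refl)))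

  Sat-ext : ∀ {a a' : Assignment n ℓ} {φ : CNF n ℓ} → (∀ v → a v ≡ a' v) → Sat a φ → Sat a' φ
  Sat-ext a≗a' = All.map (Any.map (λ {l} al → trans (sym (a≗a' (proj₁ l))) al))

  inputs : Assignment n ℓ → Fin n → Bool
  inputs a i = a (inj₁ i)

  auxiliaries : Assignment n ℓ → Fin ℓ → Bool
  auxiliaries a k = a (inj₂ k)

  split : (a : Assignment n ℓ) → ∀ v → a v ≡ (inputs a ⊕ auxiliaries a) v
  split a (inj₁ _) = refl
  split a (inj₂ _) = refl

  allVars : List (Var n ℓ)
  allVars = map inj₁ (allFin n) ++ map inj₂ (allFin ℓ)

  ∈-allVars : ∀ v → v ∈ allVars
  ∈-allVars (inj₁ i) = ∈-++⁺ˡ (∈-map⁺ inj₁ (∈-allFin i))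
  ∈-allVars (inj₂ k) = ∈-++⁺ʳ (map inj₁ (allFin n)) (∈-map⁺ inj₂ (∈-allFin k))

  allLits : List (Lit n ℓ)
  allLits = cartesianProduct allVars (true ∷ false ∷ [])

  ∈-allLits : ∀ l → l ∈ allLits
  ∈-allLits (v , true)  = ∈-cartesianProduct⁺ (∈-allVars v) (here refl)
  ∈-allLits (v , false) = ∈-cartesianProduct⁺ (∈-allVars v) (there (here refl))

Encodes : ∀ {n ℓ} → ((Fin n → Bool) → Set) → CNF n ℓ → Set
Encodes {n} f φ = ∀ (α : Fin n → Bool) → f α ⇔ (∃[ β ] Sat (α ⊕ β) φ)

model⇒f : ∀ {n ℓ} {f} {φ : CNF n ℓ} → Encodes f φ → ∀ a → Sat a φ → f (inputs a)
model⇒f enc a sat = Equivalence.from (enc (inputs a)) (auxiliaries a , Sat-ext (split a) sat)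

sound : ∀ {n ℓ} {φ : CNF n ℓ} {g} (a : Assignment n ℓ) → Sat a φ → SatLit a g →
        ∀ {c} → UDerives φ g c → SatClause a c
sound a sat ag (axiom c∈φ) = All.lookup sat c∈φ
sound a sat ag unit        = here ag
sound a sat ag (resolve {l} dl dc nl∈c) with sound a sat ag dl | find (sound a sat ag dc)
... | here al | p , p∈c , ap =
  lose (∈-removeLit⁺ p∈c (λ { refl → SatLit-neg a l al ap })) ap

sound-unit : ∀ {n ℓ} {φ : CNF n ℓ} {g h} (a : Assignment n ℓ) → Sat a φ → SatLit a g →
             φ ∧ g ⊢₁ h → SatLit a h
sound-unit a sat ag d with sound a sat ag d
... | here ah = ah

-- Unit propagation in 2-CNF formulas

implication? : ∀ {A B : Set} → Dec A → Dec B → (A → B) ⊎ (A × ¬ B)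
implication? _        (yes b) = inj₁ (λ _ → b)
implication? (no ¬a)  (no _)  = inj₁ (λ a → ⊥-elim (¬a a))
implication? (yes a)  (no ¬b) = inj₂ (a , ¬b)

module Propagation {n ℓ : ℕ} (φ : CNF n ℓ) (g : Lit n ℓ) where

  Derivable : Lit n ℓ → Set
  Derivable m = φ ∧ g ⊢₁ m

  Resolves : List (Lit n ℓ) → Clause n ℓ → Set
  Resolves R c = ∀ {p} → p ∈ c → neg p ∈ R → Any (_∈ R) c

  record Saturated (R : List (Lit n ℓ)) : Set where
    field
      derivable : All Derivable R
      start     : g ∈ R
      resolves  : All (Resolves R) φ

  resolve-on : ∀ {p c} → c ∈ φ → p ∈ c → Derivable (neg p) → UDerives φ g (removeLit p c)
  resolve-on {p} {c} c∈φ p∈c d =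
    subst (λ x → UDerives φ g (removeLit x c)) (neg-involutive p)
      (resolve d (axiom c∈φ) (subst (_∈ c) (sym (neg-involutive p)) p∈c))

  NewLiteral : List (Lit n ℓ) → Set
  NewLiteral R = ∃[ m ] (m ∉ R × Derivable m)

  check : ∀ R → All Derivable R → ∀ {c} → c ∈ φ → WFClause c → length c ≤ 2 →
          NewLiteral R ⊎ Resolves R c
  check R ders {[]} c∈φ wf len = inj₂ (λ ())
  check R ders {p ∷ []} c∈φ wf len with p ∈? R
  ... | yes p∈R = inj₂ (λ { (here refl) _ → here p∈R })
  ... | no p∉R  = inj₁ (p , p∉R , axiom c∈φ)
  check R ders {p ∷ q ∷ []} c∈φ (((p≢q ∷ []) ∷ _) , _) len
    with implication? (neg p ∈? R) (q ∈? R) | implication? (neg q ∈? R) (p ∈? R)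
  ... | inj₂ (np∈R , q∉R) | _ =
    inj₁ (q , q∉R , subst (UDerives φ g) (removeLit-first p≢q)
                          (resolve-on c∈φ (here refl) (All.lookup ders np∈R)))
  ... | inj₁ _ | inj₂ (nq∈R , p∉R) =
    inj₁ (p , p∉R , subst (UDerives φ g) (removeLit-second p≢q)
                          (resolve-on c∈φ (there (here refl)) (All.lookup ders nq∈R)))
  ... | inj₁ np⇒q | inj₁ nq⇒p =
    inj₂ (λ { (here refl) np∈R → there (here (np⇒q np∈R))
            ; (there (here refl)) nq∈R → here (nq⇒p nq∈R) })
  check R ders {_ ∷ _ ∷ _ ∷ _} c∈φ wf (s≤s (s≤s ()))

  unknown : List (Lit n ℓ) → ℕ
  unknown R = length (filter (λ u → ¬? (u ∈? R)) allLits)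

  unknown-drops : ∀ {m R} → m ∉ R → unknown (m ∷ R) < unknown R
  unknown-drops {m} {R} m∉R =
    filter-antitone-strict (λ u → ¬? (u ∈? R)) (λ u → ¬? (u ∈? (m ∷ R)))
      (λ u∉mR u∈R → u∉mR (there u∈R)) allLits (∈-allLits m) m∉R (λ m∉mR → m∉mR (here refl))

  -- Saturation: add new derivable literals until every clause is resolved;
  -- this terminates because unknown decreases.
  saturate-from : All WFClause φ → Is2CNF φ → (fuel : ℕ) (R : List (Lit n ℓ)) →
                  unknown R < fuel → All Derivable R → g ∈ R → Σ (List (Lit n ℓ)) Saturated
  saturate-from wf two (suc fuel) R bound ders g∈R
    with all-or-exception φ (λ c∈φ → check R ders c∈φ (All.lookup wf c∈φ) (All.lookup two c∈φ))
  ... | inj₂ res = R , record { derivable = ders ; start = g∈R ; resolves = res }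
  ... | inj₁ (m , m∉R , dm) =
    saturate-from wf two fuel (m ∷ R) (<-≤-trans (unknown-drops m∉R) (s≤s⁻¹ bound)) (dm ∷ ders) (there g∈R)

  saturate : All WFClause φ → Is2CNF φ → Σ (List (Lit n ℓ)) Saturated
  saturate wf two = saturate-from wf two (suc (unknown (g ∷ []))) (g ∷ []) (n<1+n _) (unit ∷ []) (here refl)

  -- Gluing: for a saturated R and models a ⊨ g and a' of φ, the assignment
  -- following a on the variables of R and a' elsewhere is again a model.
  module Glue {R : List (Lit n ℓ)} (satR : Saturated R) (a a' : Assignment n ℓ)
              (a⊨φ : Sat a φ) (a⊨g : SatLit a g) (a'⊨φ : Sat a' φ) where
    open Saturated satR

    R-true : ∀ {p} → p ∈ R → SatLit a p
    R-true p∈R = sound-unit a a⊨φ a⊨g (All.lookup derivable p∈R)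

    Occurs : Var n ℓ → Set
    Occurs v = (v , true) ∈ R ⊎ (v , false) ∈ R

    occurs? : ∀ v → Dec (Occurs v)
    occurs? v = ((v , true) ∈? R) ⊎-dec ((v , false) ∈? R)

    glued : Assignment n ℓ
    glued v = if does (occurs? v) then a v else a' v

    glued-occurs : ∀ {v} → Occurs v → glued v ≡ a v
    glued-occurs {v} o = cong (λ b → if b then a v else a' v) (dec-true (occurs? v) o)

    glued-fresh : ∀ {v} → ¬ Occurs v → glued v ≡ a' v
    glued-fresh {v} ¬o = cong (λ b → if b then a v else a' v) (dec-false (occurs? v) ¬o)

    glued-R : ∀ {p} → p ∈ R → SatLit glued p
    glued-R {v , true}  p∈R = trans (glued-occurs (inj₁ p∈R)) (R-true p∈R)
    glued-R {v , false} p∈R = trans (glued-occurs (inj₂ p∈R)) (R-true p∈R)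

    occurs-sign : ∀ p → Occurs (proj₁ p) → p ∈ R ⊎ neg p ∈ R
    occurs-sign (v , true)  o = o
    occurs-sign (v , false) o = swap o

    glued-model : Sat glued φ
    glued-model = All.tabulate glued-clause
      where
        glued-clause : ∀ {c} → c ∈ φ → SatClause glued c
        glued-clause {c} c∈φ with find (All.lookup a'⊨φ c∈φ)
        ... | p , p∈c , a'p with occurs? (proj₁ p)
        ...   | no ¬o = lose p∈c (trans (glued-fresh ¬o) a'p)
        ...   | yes o with occurs-sign p o
        ...     | inj₁ p∈R  = lose p∈c (glued-R p∈R)
        ...     | inj₂ np∈R = Any.map glued-R (All.lookup resolves c∈φ p∈c np∈R)

update : ∀ {A : Set} → DecidableEquality A → (A → Bool) → A → Bool → A → Bool
update _≟_ f x b y = if does (y ≟ x) then b else f y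

update-same : ∀ {A : Set} (_≟_ : DecidableEquality A) f x b → update _≟_ f x b x ≡ b
update-same _≟_ f x b = cong (λ d → if d then b else f x) (dec-true (x ≟ x) refl)

update-other : ∀ {A : Set} (_≟_ : DecidableEquality A) f {x} b {y} → y ≢ x → update _≟_ f x b y ≡ f y
update-other _≟_ f {x} b {y} y≢x = cong (λ d → if d then b else f y) (dec-false (y ≟ x) y≢x)

module _ {n ℓ : ℕ} where

  _≟V_ : DecidableEquality (Var n ℓ)
  _≟V_ = SumP.≡-dec _≟F_ _≟F_

  unit-holds : ∀ {φ : CNF n ℓ} {l} → UnitImplicate φ l → ∀ a → Sat a φ → SatLit a l
  unit-holds imp a sat with imp a sat
  ... | here al = al

  other-variable : ∀ {v s} (p : Lit n ℓ) → p ≢ (v , s) → p ≢ (v , not s) → proj₁ p ≢ v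
  other-variable {s = true}  (v , true)  p≢l _    refl = p≢l refl
  other-variable {s = true}  (v , false) _   p≢nl refl = p≢nl refl
  other-variable {s = false} (v , true)  _   p≢nl refl = p≢nl refl
  other-variable {s = false} (v , false) p≢l _    refl = p≢l refl

  -- A unit implicate of a satisfiable formula occurs in one of its clauses:
  -- otherwise flipping its variable in a model would give another model.
  unit-occurs : ∀ {φ : CNF n ℓ} {l} a → Sat a φ → UnitImplicate φ l → Any (l ∈_) φ
  unit-occurs {φ} {v , s} a sat imp with Any.any? ((v , s) ∈?_) φ
  ... | yes occ = occ
  ... | no ¬occ = ⊥-elim (not-¬ (unit-holds imp flipped flipped-model) (update-same _≟V_ a v (not s)))
    where
      flipped : Assignment n ℓ
      flipped = update _≟V_ a v (not s)

      flipped-model : Sat flipped φ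
      flipped-model = All.tabulate flipped-clause
        where
          flipped-clause : ∀ {c} → c ∈ φ → SatClause flipped c
          flipped-clause {c} c∈φ with find (All.lookup sat c∈φ)
          ... | (w , t) , p∈c , aw≡t with w ≟V v
          ...   | no w≢v    = lose p∈c (trans (update-other _≟V_ a (not s) w≢v) aw≡t)
          ...   | yes refl  = ⊥-elim (¬occ (lose c∈φ (subst (λ b → (v , b) ∈ c) t≡s p∈c)))
            where t≡s = trans (sym aw≡t) (unit-holds imp a sat)

-- Eliminating a unit implicate on an auxiliary variable

-- Clauses up to having the same literals form a decidable setoid; merging
-- equal clauses with deduplicate restores a well-formed CNF.
clauseDecSetoid : ℕ → ℕ → DecSetoid 0ℓ 0ℓ
clauseDecSetoid n ℓ = record
  { Carrier = Clause n ℓ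
  ; _≈_ = SameClause
  ; isDecEquivalence = record
    { isEquivalence = record
      { refl  = ⊆-refl , ⊆-refl
      ; sym   = λ (c⊆d , d⊆c) → d⊆c , c⊆d
      ; trans = λ (c⊆d , d⊆c) (d⊆e , e⊆d) → ⊆-trans c⊆d d⊆e , ⊆-trans e⊆d d⊆c }
    ; _≟_ = λ c d → (c ⊆? d) ×-dec (d ⊆? c) } }
  where open import Data.List.Relation.Binary.Subset.DecPropositional (_≟L_ {n} {ℓ}) using (_⊆?_)

mergeClauses : ∀ {n ℓ} → CNF n ℓ → CNF n ℓ
mergeClauses {n} {ℓ} = deduplicate (DecSetoid._≟_ (clauseDecSetoid n ℓ))

length-mergeClauses : ∀ {n ℓ} (φ : CNF n ℓ) → length (mergeClauses φ) ≤ length φ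
length-mergeClauses []      = z≤n
length-mergeClauses (c ∷ φ) = s≤s (≤-trans (length-filter _ (mergeClauses φ)) (length-mergeClauses φ))

module Eliminate {n ℓ : ℕ} (φ : CNF n ℓ) (k : Fin ℓ) (s : Bool) where

  l : Lit n ℓ
  l = (inj₂ k , s)

  avoids-l? : (c : Clause n ℓ) → Dec (l ∉ c)
  avoids-l? c = ¬? (l ∈? c)

  shortened : CNF n ℓ
  shortened = map (removeLit (neg l)) (filter avoids-l? φ)

  reduced : CNF n ℓ
  reduced = mergeClauses shortened

  reduced-origin : ∀ {d} → d ∈ reduced → ∃[ c ] (c ∈ φ × l ∉ c × d ≡ removeLit (neg l) c)
  reduced-origin d∈ with ∈-map⁻ (removeLit (neg l)) (AnyP.deduplicate⁻ _ d∈)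
  ... | c , c∈ , refl with ∈-filter⁻ avoids-l? c∈
  ...   | c∈φ , l∉c = c , c∈φ , l∉c , refl

  reduced-representative : ∀ {c} → c ∈ φ → l ∉ c → ∃[ d ] (d ∈ reduced × SameClause (removeLit (neg l) c) d)
  reduced-representative c∈φ l∉c =
    find (AnyP.deduplicate⁺ _ (λ d≈e c≈e → DecSetoid.trans S c≈e (DecSetoid.sym S d≈e))
           (lose (∈-map⁺ (removeLit (neg l)) (∈-filter⁺ avoids-l? c∈φ l∉c)) (DecSetoid.refl S)))
    where S = clauseDecSetoid n ℓ

  reduced-wf : WFCNF φ → WFCNF reduced
  reduced-wf (wf , _) = All.tabulate clause-wf , deduplicate-! (clauseDecSetoid n ℓ) shortened
    where
      clause-wf : ∀ {d} → d ∈ reduced → WFClause d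
      clause-wf d∈ with reduced-origin d∈
      ... | c , c∈φ , _ , refl with All.lookup wf c∈φ
      ...   | unique , consistent =
        UniqueP.filter⁺ (removeLit? (neg l)) unique ,
        λ p p∈ np∈ → consistent p (proj₁ (∈-removeLit⁻ p∈)) (proj₁ (∈-removeLit⁻ np∈))

  reduced-2CNF : Is2CNF φ → Is2CNF reduced
  reduced-2CNF two = All.tabulate clause-short
    where
      clause-short : ∀ {d} → d ∈ reduced → length d ≤ 2
      clause-short d∈ with reduced-origin d∈
      ... | c , c∈φ , _ , refl = ≤-trans (length-filter (removeLit? (neg l)) c) (All.lookup two c∈φ)

  reduced-smaller : Any (l ∈_) φ → size reduced < size φ
  reduced-smaller occ = begin-strict
    length reduced                          ≤⟨ length-mergeClauses shortened ⟩
    length shortened                        ≡⟨ length-map (removeLit (neg l)) (filter avoids-l? φ) ⟩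
    length (filter avoids-l? φ)             <⟨ filter-notAll avoids-l? φ (Any.map (λ l∈c l∉c → l∉c l∈c) occ) ⟩
    length φ                                ∎
    where open ≤-Reasoning

  reduced-encodes : ∀ {f} → UnitImplicate φ l → Encodes f φ → Encodes f reduced
  reduced-encodes {f} imp enc α = mk⇔ to from
    where
      -- A model of φ satisfies l, so no clause is satisfied only by ¬l.
      to : f α → ∃[ β ] Sat (α ⊕ β) reduced
      to fα with Equivalence.to (enc α) fα
      ... | β , sat = β , All.tabulate clause
        where
          clause : ∀ {d} → d ∈ reduced → SatClause (α ⊕ β) d
          clause d∈ with reduced-origin d∈
          ... | c , c∈φ , _ , refl with find (All.lookup sat c∈φ)
          ...   | p , p∈c , ap =
            lose (∈-removeLit⁺ p∈c (λ { refl → SatLit-neg (α ⊕ β) l (unit-holds imp (α ⊕ β) sat) ap })) ap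

      -- Setting y_k to s makes the clauses containing l true and leaves the
      -- others satisfied.
      from : ∃[ β ] Sat (α ⊕ β) reduced → f α
      from (β , sat) = Equivalence.from (enc α) (β' , All.tabulate clause)
        where
          β' : Fin ℓ → Bool
          β' = update _≟F_ β k s

          agrees : ∀ w → w ≢ inj₂ k → (α ⊕ β') w ≡ (α ⊕ β) w
          agrees (inj₁ _)  _      = refl
          agrees (inj₂ k') k'≢k = update-other _≟F_ β s (λ k'≡k → k'≢k (cong inj₂ k'≡k))

          clause : ∀ {c} → c ∈ φ → SatClause (α ⊕ β') c
          clause {c} c∈φ with l ∈? c
          ... | yes l∈c = lose l∈c (update-same _≟F_ β k s)
          ... | no l∉c with reduced-representative c∈φ l∉c
          ...   | d , d∈ , (_ , d⊆) with find (All.lookup sat d∈)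
          ...     | p , p∈d , ap with ∈-removeLit⁻ (d⊆ p∈d)
          ...       | p∈c , p≢nl =
            lose p∈c (trans (agrees (proj₁ p) (other-variable p (λ { refl → l∉c p∈c }) p≢nl)) ap)

module _ {n ℓ : ℕ} where

  proper-subclause-single : ∀ {c d : Clause n ℓ} → length c ≤ 2 → ProperSubclause d c →
                            ∃[ r ] (∀ {x} → x ∈ d → x ≡ r)
  proper-subclause-single {[]} _ (_ , c⊈d) = ⊥-elim (c⊈d (λ ()))
  proper-subclause-single {p ∷ []} _ (d⊆c , _) = p , only ∘ d⊆c
    where
      only : ∀ {x} → x ∈ p ∷ [] → x ≡ p
      only (here x≡p) = x≡p
  proper-subclause-single {p ∷ q ∷ []} {d} _ (d⊆c , c⊈d) with p ∈? d | q ∈? d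
  ... | yes p∈d | yes q∈d = ⊥-elim (c⊈d (λ { (here refl) → p∈d ; (there (here refl)) → q∈d }))
  ... | no p∉d  | _       = q , other
    where
      other : ∀ {x} → x ∈ d → x ≡ q
      other x∈d with d⊆c x∈d
      ... | here refl        = ⊥-elim (p∉d x∈d)
      ... | there (here x≡q) = x≡q
  ... | yes _   | no q∉d  = p , other
    where
      other : ∀ {x} → x ∈ d → x ≡ p
      other x∈d with d⊆c x∈d
      ... | here x≡p          = x≡p
      ... | there (here refl) = ⊥-elim (q∉d x∈d)
  proper-subclause-single {_ ∷ _ ∷ _ ∷ _} (s≤s (s≤s ())) _

  single-implicate : ∀ {φ : CNF n ℓ} {d r} → (∀ {x} → x ∈ d → x ≡ r) →
                     Implicate φ d → UnitImplicate φ r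
  single-implicate same imp a sat with find (imp a sat)
  ... | x , x∈d , ax = here (subst (SatLit a) (same x∈d) ax)

  prime-if-no-units : ∀ {φ : CNF n ℓ} → Is2CNF φ → HasNoUnitImplicates φ → IsPrime φ
  prime-if-no-units two no-units = All.tabulate λ c∈φ →
    (λ a sat → All.lookup sat c∈φ) ,
    λ d proper imp → let r , same = proper-subclause-single (All.lookup two c∈φ) proper
                     in no-units r (single-implicate same imp)

module _ {n : ℕ} where

  oneHot : Fin n → Fin n → Bool
  oneHot i j = does (j ≟F i)

  oneHot-self : ∀ i → oneHot i i ≡ true
  oneHot-self i = dec-true (i ≟F i) refl

  oneHot-true : ∀ {i j} → oneHot i j ≡ true → j ≡ i
  oneHot-true {i} {j} eq with j ≟F i | eq
  ... | yes j≡i | _ = j≡i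
  ... | no _    | ()

  AMO-oneHot : ∀ i → AMO n (oneHot i)
  AMO-oneHot i j k ej ek = trans (oneHot-true ej) (sym (oneHot-true ek))

  AMO-allFalse : AMO n (λ _ → false)
  AMO-allFalse j k ()

  AMO-below-oneHot : Fin n → ∀ {α} → AMO n α → ∃[ i ] (∀ t → α t ≡ true → t ≡ i)
  AMO-below-oneHot i₀ {α} amo with FinP.any? (λ t → α t ≟B true)
  ... | yes (i , αi) = i , λ t αt → amo t i αt αi
  ... | no none      = i₀ , λ t αt → ⊥-elim (none (t , αt))

empty-encodes-AMO₀ : ∀ {ℓ} → EncodesAMO {0} {ℓ} []
empty-encodes-AMO₀ α = mk⇔ (λ _ → (λ _ → false) , []) (λ _ ())

module MinimumEncoding {n ℓ : ℕ} (φ : CNF n ℓ) (wf : WFCNF φ) (two : Is2CNF φ) (enc : EncodesAMO φ)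
  (minimal : ∀ (ℓ' : ℕ) (ψ : CNF n ℓ') → WFCNF ψ → Is2CNF ψ → EncodesAMO ψ → size φ ≤ size ψ) where

  model : Fin n → Assignment n ℓ
  model i = oneHot i ⊕ proj₁ (Equivalence.to (enc (oneHot i)) (AMO-oneHot i))

  model-sat : ∀ i → Sat (model i) φ
  model-sat i = proj₂ (Equivalence.to (enc (oneHot i)) (AMO-oneHot i))

  zeroModel : Assignment n ℓ
  zeroModel = (λ _ → false) ⊕ proj₁ (Equivalence.to (enc _) AMO-allFalse)

  zeroModel-sat : Sat zeroModel φ
  zeroModel-sat = proj₂ (Equivalence.to (enc _) AMO-allFalse)

  -- x_i fails in the all-false model, ¬x_i in the model of e_i; a unit
  -- implicate on an auxiliary variable could be eliminated, giving a smaller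
  -- encoding.
  no-unit-implicates : HasNoUnitImplicates φ
  no-unit-implicates (inj₁ i , true) imp with unit-holds imp zeroModel zeroModel-sat
  ... | ()
  no-unit-implicates (inj₁ i , false) imp =
    not-¬ (oneHot-self i) (unit-holds imp (model i) (model-sat i))
  no-unit-implicates (inj₂ k , s) imp =
    <-irrefl refl (<-≤-trans (reduced-smaller (unit-occurs zeroModel zeroModel-sat imp))
                             (minimal ℓ reduced (reduced-wf wf) (reduced-2CNF two) (reduced-encodes imp enc)))
    where open Eliminate φ k s

  prime : IsPrime φ
  prime = prime-if-no-units two no-unit-implicates

  -- Unit propagation from x_i reaches ¬x_j: otherwise gluing the models of
  -- e_i and e_j along the propagated literals sets both x_i and x_j.
  propagates : ∀ i j → i ≢ j → φ ∧ pos (inj₁ i) ⊢₁ negv (inj₁ j)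
  propagates i j i≢j = reaches (saturate (proj₁ wf) two)
    where
      open Propagation φ (pos (inj₁ i))

      reaches : Σ (List (Lit n ℓ)) Saturated → φ ∧ pos (inj₁ i) ⊢₁ negv (inj₁ j)
      reaches (R , satR) with negv (inj₁ j) ∈? R
      ... | yes nxj∈R = All.lookup (Saturated.derivable satR) nxj∈R
      ... | no nxj∉R  = ⊥-elim (i≢j (model⇒f enc glued glued-model i j glued-xi glued-xj))
        where
          open Glue satR (model i) (model j) (model-sat i) (oneHot-self i) (model-sat j)

          -- x_j cannot be in R (it is false in the model of e_i), and ¬x_j is not.
          xj-fresh : ¬ Occurs (inj₁ j)
          xj-fresh (inj₁ xj∈R)  = i≢j (sym (oneHot-true (R-true xj∈R)))
          xj-fresh (inj₂ nxj∈R) = nxj∉R nxj∈R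

          glued-xi : glued (inj₁ i) ≡ true
          glued-xi = glued-R (Saturated.start satR)

          glued-xj : glued (inj₁ j) ≡ true
          glued-xj = trans (glued-fresh xj-fresh) (oneHot-self j)

  P-encoding : IsPEncoding φ
  P-encoding = (λ i → model i , model-sat i , oneHot-self i) , propagates

-- The lower bound: a 2-CNF P-encoding contains an encoding of AMO

PositiveInput : ∀ {n ℓ} → Lit n ℓ → Set
PositiveInput (inj₁ _ , true)  = ⊤
PositiveInput (inj₁ _ , false) = ⊥
PositiveInput (inj₂ _ , _)     = ⊥

positiveInput? : ∀ {n ℓ} (p : Lit n ℓ) → Dec (PositiveInput p)
positiveInput? (inj₁ _ , true)  = yes tt
positiveInput? (inj₁ _ , false) = no λ ()
positiveInput? (inj₂ _ , _)     = no λ ()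

module NegativePart {n ℓ : ℕ} (ψ : CNF n ℓ) (two : Is2CNF ψ) (P : IsPEncoding ψ) where

  negative? : (c : Clause n ℓ) → Dec (¬ Any PositiveInput c)
  negative? c = ¬? (Any.any? positiveInput? c)

  negativePart : CNF n ℓ
  negativePart = filter negative? ψ

  -- By (P1), a model of ψ with x_i = 1; by (P2) and soundness, its other
  -- inputs are 0.
  model : Fin n → Assignment n ℓ
  model i = proj₁ (proj₁ P i)

  model-sat : ∀ i → Sat (model i) ψ
  model-sat i = proj₁ (proj₂ (proj₁ P i))

  model-self : ∀ i → model i (inj₁ i) ≡ true
  model-self i = proj₂ (proj₂ (proj₁ P i))

  model-other : ∀ {i t} → model i (inj₁ t) ≡ true → t ≡ i
  model-other {i} {t} it with t ≟F i
  ... | yes t≡i = t≡i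
  ... | no t≢i  = ⊥-elim (not-¬ it (sound-unit (model i) (model-sat i) (model-self i)
                                                (proj₂ P i t (λ i≡t → t≢i (sym i≡t)))))

  -- Encoding, easy direction: an AMO vector lies below some e_i, and the
  -- auxiliary part of the model of x_i completes it.
  extend : Fin n → ∀ α → AMO n α → ∃[ β ] Sat (α ⊕ β) negativePart
  extend i₀ α amo with AMO-below-oneHot i₀ amo
  ... | i , below = auxiliaries (model i) , All.tabulate clause
    where
      -- Auxiliary literals keep their value, negative input literals hold as
      -- α is 0 outside i, and positive input literals do not occur.
      literal : ∀ {c} → ¬ Any PositiveInput c → ∀ {p} → p ∈ c → SatLit (model i) p → SatLit (α ⊕ auxiliaries (model i)) p
      literal _   {inj₂ k , s}     _   ap = ap
      literal neg {inj₁ t , true}  p∈c _  = ⊥-elim (neg (lose p∈c tt))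
      literal _   {inj₁ t , false} _   ap =
        ¬-not λ αt → not-¬ (model-self i) (subst (λ u → model i (inj₁ u) ≡ false) (below t αt) ap)

      clause : ∀ {c} → c ∈ negativePart → SatClause (α ⊕ auxiliaries (model i)) c
      clause c∈ with ∈-filter⁻ negative? c∈
      ... | c∈ψ , neg with find (All.lookup (model-sat i) c∈ψ)
      ...   | p , p∈c , ap = lose p∈c (literal neg p∈c ap)

  -- Encoding, hard direction: if b ⊨ negativePart had x_i = x_j = 1 with
  -- i ≠ j, the bitwise majority m of b, model i and model j would satisfy ψ
  -- (each 2-clause has a literal true in two of the three, or is a positive
  -- input literal x_i, x_j which m sets) and (P2) would force m(x_j) = 0.
  module Majority (b : Assignment n ℓ) (b-sat : Sat b negativePart) (i j : Fin n)
                  (bi : b (inj₁ i) ≡ true) (bj : b (inj₁ j) ≡ true) where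

    m : Assignment n ℓ
    m v = majority (b v) (model i v) (model j v)

    sat-12 : ∀ {p} → SatLit b p × SatLit (model i) p → SatLit m p
    sat-12 {v , _} (x , y) = majority-12 (b v) (model i v) (model j v) x y

    sat-13 : ∀ {p} → SatLit b p × SatLit (model j) p → SatLit m p
    sat-13 {v , _} (x , z) = majority-13 (b v) (model i v) (model j v) x z

    sat-23 : ∀ {p} → SatLit (model i) p × SatLit (model j) p → SatLit m p
    sat-23 {v , _} (y , z) = majority-23 (b v) (model i v) (model j v) y z

    m-i : m (inj₁ i) ≡ true
    m-i = majority-12 (b (inj₁ i)) (model i (inj₁ i)) _ bi (model-self i)

    m-j : m (inj₁ j) ≡ true
    m-j = majority-13 (b (inj₁ j)) _ (model j (inj₁ j)) bj (model-self j)

    positive-i : ∀ {p} → SatLit (model i) p × PositiveInput p → SatLit m p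
    positive-i {inj₁ t , true} (it , _) rewrite model-other it = m-i

    positive-j : ∀ {p} → SatLit (model j) p × PositiveInput p → SatLit m p
    positive-j {inj₁ t , true} (jt , _) rewrite model-other jt = m-j

    m-sat : Sat m ψ
    m-sat = All.tabulate clause
      where
        clause : ∀ {c} → c ∈ ψ → SatClause m c
        clause {c} c∈ψ with negative? c
        ... | yes neg = [ Any.map sat-12 , [ Any.map sat-13 , Any.map sat-23 ] ]
          (two-of-three (All.lookup two c∈ψ) (All.lookup b-sat (∈-filter⁺ negative? c∈ψ neg))
                        (All.lookup (model-sat i) c∈ψ) (All.lookup (model-sat j) c∈ψ))
        ... | no ¬neg = [ Any.map sat-23 , [ Any.map positive-i , Any.map positive-j ] ]
          (two-of-three (All.lookup two c∈ψ) (All.lookup (model-sat i) c∈ψ)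
                        (All.lookup (model-sat j) c∈ψ) (decidable-stable (Any.any? positiveInput? c) ¬neg))

  negativePart-AMO : ∀ b → Sat b negativePart → AMO n (inputs b)
  negativePart-AMO b b-sat i j bi bj with i ≟F j
  ... | yes i≡j = i≡j
  ... | no i≢j  = ⊥-elim (not-¬ m-j (sound-unit m m-sat m-i (proj₂ P i j i≢j)))
    where open Majority b b-sat i j bi bj

  negativePart-encodes : Fin n → EncodesAMO negativePart
  negativePart-encodes i₀ α = mk⇔ (extend i₀ α) (λ (β , sat) → negativePart-AMO (α ⊕ β) sat)

  negativePart-wf : WFCNF ψ → WFCNF negativePart
  negativePart-wf (clauses , distinct) = AllP.filter⁺ negative? clauses , AllPairsP.filter⁺ negative? distinct

  negativePart-2CNF : Is2CNF negativePart
  negativePart-2CNF = AllP.filter⁺ negative? two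

  negativePart-size : size negativePart ≤ size ψ
  negativePart-size = length-filter negative? ψ

-- Hence a minimum 2-CNF encoding of AMO_n is no larger than any 2-CNF
-- P-encoding (for n = 0 the empty formula is a minimum encoding).
minimum-below-P-encodings : ∀ {n ℓ} {φ : CNF n ℓ} → IsMin2CNFEncodingAMO φ →
  ∀ (ℓ' : ℕ) (ψ : CNF n ℓ') → WFCNF ψ → Is2CNF ψ → IsPEncoding ψ → size φ ≤ size ψ
minimum-below-P-encodings {zero} (_ , _ , _ , minimal) ℓ' ψ _ _ _ =
  ≤-trans (minimal 0 [] ([] , []) [] empty-encodes-AMO₀) z≤n
minimum-below-P-encodings {suc _} (_ , _ , _ , minimal) ℓ' ψ wf two P =
  ≤-trans (minimal ℓ' negativePart (negativePart-wf wf) negativePart-2CNF (negativePart-encodes Fin.zero))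
          negativePart-size
  where open NegativePart ψ two P

lemma17 : (n ℓ : ℕ) (φ : CNF n ℓ) → IsMin2CNFEncodingAMO φ →
    HasNoUnitImplicates φ × IsPrime φ × IsPEncoding φ × IsS₂ n (size φ)
lemma17 n ℓ φ min@(wf , two , enc , minimal) =
  no-unit-implicates , prime , P-encoding ,
  (ℓ , φ , wf , two , P-encoding , refl) , minimum-below-P-encodings min
  where open MinimumEncoding φ wf two enc minimal
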